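{- Let $(P_n)_{n\ge0}$ and $(Q_n)_{n\ge0}$ be the sequences of polynomials in $m$ defined by $P_0=Q_0=0$, $P_1(m)=Q_1(m)=m$, and for $n\ge 1$: $Q_{n+1}(m)=\sum_{k=0}^{n}Q_{n-k}(m)\,P_k(m)$ and $P_{n+1}(m)=P_n(m+1)+Q_{n+1}(m)$. For every $q\ge 0$, the leading coefficient of $P_{2q+1}$ (the coefficient of $m^{q+1}$) is the Catalan number $C_q=\frac{1}{q+1}\binom{2q}{q}$.
   Context: $P_n(m)$ counts beta-normal untyped lambda terms of size $n$ with de Bruijn indices in $\{1,\dots,m\}$, and $Q_n(m)$ counts those not starting with a $\lambda$. -}

module Defs where

open import Data.Nat using (ℕ; zero; suc; _+_; _*_)
open import Data.List using (List; []; _∷_; zipWith; reverse; foldr)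
open import Data.Product using (_×_; _,_; proj₁; proj₂)

-- Polynomials in one variable m with natural-number coefficients,
-- as little-endian coefficient lists: c₀ ∷ c₁ ∷ … represents c₀ + c₁ m + …
-- (all polynomials in this statement have nonnegative integer coefficients,
-- since they are built from m by +, *, and the shift m ↦ m+1).
Poly : Set
Poly = List ℕ

coeff : Poly → ℕ → ℕ
coeff []       _       = 0
coeff (c ∷ _)  zero    = c
coeff (_ ∷ p)  (suc i) = coeff p i

_⊕_ : Poly → Poly → Poly
[]      ⊕ q       = q
p       ⊕ []      = p
(a ∷ p) ⊕ (b ∷ q) = (a + b) ∷ (p ⊕ q)

scale : ℕ → Poly → Poly
scale c []      = []
scale c (a ∷ p) = (c * a) ∷ scale c p

_⊗_ : Poly → Poly → Poly
[]      ⊗ q = []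
(a ∷ p) ⊗ q = scale a q ⊕ (0 ∷ (p ⊗ q))

-- p(m) ↦ p(m+1), via Horner: p = c + m·p'  ↦  c + (m+1)·p'(m+1)
shift : Poly → Poly
shift []      = []
shift (c ∷ p) = (c ∷ []) ⊕ ((1 ∷ 1 ∷ []) ⊗ shift p)

polySum : List Poly → Poly
polySum = foldr _⊕_ []

-- PQs n = ((P_n , Q_n) , [(P_{n-1},Q_{n-1}) , … , (P_0,Q_0)])
PQs : ℕ → (Poly × Poly) × List (Poly × Poly)
PQs zero = (([] , []) , [])
PQs (suc zero) = (((0 ∷ 1 ∷ []) , (0 ∷ 1 ∷ [])) , (([] , []) ∷ []))
PQs (suc (suc n)) with PQs (suc n)
... | (hd , tl) =
  let l  = hd ∷ tl
      -- Q_{n+2} = Σ_{k=0}^{n+1} Q_{n+1-k} P_k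
      Qn = polySum (zipWith (λ a b → proj₂ a ⊗ proj₁ b) l (reverse l))
      Pn = shift (proj₁ hd) ⊕ Qn
  in ((Pn , Qn) , l)

P : ℕ → Poly
P n = proj₁ (proj₁ (PQs n))

Q : ℕ → Poly
Q n = proj₂ (proj₁ (PQs n))

module Submission where

open import Defs
open import Data.Nat using (ℕ; suc; _+_; _*_; _<_; _/_)
open import Data.Nat.Combinatorics using (_C_)
open import Data.Product using (_×_)
open import Relation.Binary.PropositionalEquality using (_≡_)

open import Data.Nat using (zero; pred; _≤_; _∸_; _<?_; z≤n; s≤s; ⌊_/2⌋; ⌈_/2⌉)
open import Data.Nat.Properties
open import Data.Nat.DivMod using (m*n/n≡m)
open import Data.Nat.Combinatorics using (nCk+nC[k+1]≡[n+1]C[k+1]; nCk≡nC[n∸k]; nC1≡n)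
open import Data.Nat.Induction using (<-rec)
open import Data.Nat.Solver using (module +-*-Solver)
open import Data.List using (List; _∷_; []; _∷ʳ_; zipWith; reverse; applyUpTo; applyDownFrom)
open import Data.List.Properties using (unfold-reverse; applyUpTo-∷ʳ)
open import Data.Product using (_,_; proj₁; proj₂)
open import Data.Sum using (_⊎_; inj₁; inj₂)
open import Data.Empty using (⊥-elim)
open import Function using (_∘_)
open import Relation.Nullary using (yes; no)
open import Relation.Binary.Definitions using (tri<; tri≈; tri>)
open import Relation.Binary.PropositionalEquality
  using (_≢_; refl; sym; trans; cong; cong₂; subst; module ≡-Reasoning)

open +-*-Solver using (solve; _:+_; _:=_)
open ≡-Reasoning

-- Everything is expressed through antidiagonal sums  conv h n = Σ_{i+j=n} h i j.
-- The coefficients of a product are such a sum (coeff-⊗), and so, by the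
-- defining recursion, are the coefficients of Q_{n+2} (Q-coeff).  From this:
--   1. deg P_n, deg Q_n ≤ ⌈n/2⌉, by strong induction (degree-bound);
--   2. the top coefficients  ℓ_q = [m^{q+1}] P_{2q+1}  satisfy the Catalan
--      recurrence ℓ_{r+1} = Σ_{i+j=r} ℓ_i ℓ_j: in Q_{2r+3} only the products
--      Q_{2j+1} P_{2i+1} reach degree r+2, and the shifted P_{2r+2} does not;
--   3. the Catalan numbers, realised as ballot numbers ballot n k = [x^n] c(x)^k
--      for the Catalan series c, satisfy this recurrence and the closed form
--      (q+1)·C_q = binom(2q, q), via the reflection formula
--      [x^{n+1}] c^{k+1} = binom(2n+k+2, n+1) − binom(2n+k+2, n).
-- Uniqueness of solutions of the recurrence then gives the theorem.

conv : (ℕ → ℕ → ℕ) → ℕ → ℕ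
conv h zero    = h 0 0
conv h (suc n) = h 0 (suc n) + conv (λ i j → h (suc i) j) n

conv-cong : ∀ n h h′ → (∀ i j → i + j ≡ n → h i j ≡ h′ i j) → conv h n ≡ conv h′ n
conv-cong zero    h h′ eq = eq 0 0 refl
conv-cong (suc n) h h′ eq =
  cong₂ _+_ (eq 0 (suc n) refl)
    (conv-cong n (λ i j → h (suc i) j) (λ i j → h′ (suc i) j) (λ i j e → eq (suc i) j (cong suc e)))

conv-zero : ∀ h n → (∀ i j → i + j ≡ n → h i j ≡ 0) → conv h n ≡ 0
conv-zero h zero    z = z 0 0 refl
conv-zero h (suc n) z =
  cong₂ _+_ (z 0 (suc n) refl) (conv-zero (λ i j → h (suc i) j) n (λ i j e → z (suc i) j (cong suc e)))

conv-single : ∀ h {n} i₀ j₀ → i₀ + j₀ ≡ n →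
  (∀ i j → i + j ≡ n → i ≢ i₀ → h i j ≡ 0) → conv h n ≡ h i₀ j₀
conv-single h zero    zero       refl off = refl
conv-single h zero    (suc j₀)   refl off =
  trans (cong (h 0 (suc j₀) +_)
               (conv-zero (λ i j → h (suc i) j) j₀ (λ i j e → off (suc i) j (cong suc e) (λ ()))))
        (+-identityʳ _)
conv-single h (suc i₀) j₀        refl off =
  cong₂ _+_ (off 0 (suc (i₀ + j₀)) refl (λ ()))
    (conv-single (λ i j → h (suc i) j) i₀ j₀ refl
      (λ i j e i≢i₀ → off (suc i) j (cong suc e) (i≢i₀ ∘ suc-injective)))

conv-split : ∀ h h₁ h₂ → (∀ i → h i 0 ≡ h₁ i 0) →
  (∀ i j → h i (suc j) ≡ h₁ i (suc j) + h₂ i j) →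
  ∀ n → conv h (suc n) ≡ conv h₁ (suc n) + conv h₂ n
conv-split h h₁ h₂ e₀ eₛ zero
  rewrite eₛ 0 0 | e₀ 1 =
  solve 3 (λ a b c → (a :+ b) :+ c := (a :+ c) :+ b) refl (h₁ 0 1) (h₂ 0 0) (h₁ 1 0)
conv-split h h₁ h₂ e₀ eₛ (suc n)
  rewrite eₛ 0 (suc n)
        | conv-split (λ i j → h (suc i) j) (λ i j → h₁ (suc i) j) (λ i j → h₂ (suc i) j)
            (λ i → e₀ (suc i)) (λ i → eₛ (suc i)) n =
  solve 4 (λ a b x y → (a :+ b) :+ (x :+ y) := (a :+ x) :+ (b :+ y)) refl
    (h₁ 0 (suc (suc n))) (h₂ 0 (suc n))
    (conv (λ i j → h₁ (suc i) j) (suc n)) (conv (λ i j → h₂ (suc i) j) n)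

-- n ↦ 2n by recursion, so that double (suc n) unfolds to suc (suc (double n)).
double : ℕ → ℕ
double zero    = zero
double (suc n) = suc (suc (double n))

double≡+ : ∀ n → double n ≡ n + n
double≡+ zero    = refl
double≡+ (suc n) = cong suc (trans (cong suc (double≡+ n)) (sym (+-suc n n)))

-- On an even antidiagonal i + j = 2r+2 the indices are both even or both odd.
conv-parity : ∀ h r → conv h (double (suc r)) ≡
  conv (λ i j → h (double i) (double j)) (suc r) + conv (λ i j → h (suc (double i)) (suc (double j))) r
conv-parity h zero =
  solve 3 (λ a b c → a :+ (b :+ c) := (a :+ c) :+ b) refl (h 0 2) (h 1 1) (h 2 0)
conv-parity h (suc r)
  rewrite conv-parity (λ i j → h (suc (suc i)) j) r =
  solve 4 (λ a b x y → a :+ (b :+ (x :+ y)) := (a :+ x) :+ (b :+ y)) refl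
    (h 0 (double (suc (suc r)))) (h 1 (suc (double (suc r))))
    (conv (λ i j → h (suc (suc (double i))) (double j)) (suc r))
    (conv (λ i j → h (suc (suc (suc (double i)))) (suc (double j))) r)

coeff-⊕ : ∀ p q j → coeff (p ⊕ q) j ≡ coeff p j + coeff q j
coeff-⊕ []      q       j       = refl
coeff-⊕ (a ∷ p) []      j       = sym (+-identityʳ _)
coeff-⊕ (a ∷ p) (b ∷ q) zero    = refl
coeff-⊕ (a ∷ p) (b ∷ q) (suc j) = coeff-⊕ p q j

coeff-scale : ∀ c p j → coeff (scale c p) j ≡ c * coeff p j
coeff-scale c []      j       = sym (*-zeroʳ c)
coeff-scale c (a ∷ p) zero    = refl
coeff-scale c (a ∷ p) (suc j) = coeff-scale c p j

coeff-⊗ : ∀ p q n → coeff (p ⊗ q) n ≡ conv (λ i j → coeff p i * coeff q j) n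
coeff-⊗ []      q n = sym (conv-zero _ n (λ _ _ _ → refl))
coeff-⊗ (a ∷ p) q n = trans (coeff-⊕ (scale a q) (0 ∷ (p ⊗ q)) n) (cons-case n)
  where
  cons-case : ∀ n → coeff (scale a q) n + coeff (0 ∷ (p ⊗ q)) n ≡
                    conv (λ i j → coeff (a ∷ p) i * coeff q j) n
  cons-case zero    = trans (+-identityʳ _) (coeff-scale a q 0)
  cons-case (suc n) = cong₂ _+_ (coeff-scale a q (suc n)) (coeff-⊗ p q n)

record DegreeBelow (p : Poly) (d : ℕ) : Set where
  constructor degree-below
  field
    vanishes : ∀ j → d ≤ j → coeff p j ≡ 0
open DegreeBelow

degree-mono : ∀ {p a b} → DegreeBelow p a → a ≤ b → DegreeBelow p b
degree-mono deg a≤b = degree-below λ j b≤j → vanishes deg j (≤-trans a≤b b≤j)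

degree-⊕ : ∀ {p q d} → DegreeBelow p d → DegreeBelow q d → DegreeBelow (p ⊕ q) d
degree-⊕ {p} {q} degp degq =
  degree-below λ j d≤j → trans (coeff-⊕ p q j) (cong₂ _+_ (vanishes degp j d≤j) (vanishes degq j d≤j))

degree-tail : ∀ {c p d} → DegreeBelow (c ∷ p) d → DegreeBelow p (pred d)
degree-tail {d = zero}  deg = degree-below λ j _   → vanishes deg (suc j) z≤n
degree-tail {d = suc d} deg = degree-below λ j d≤j → vanishes deg (suc j) (s≤s d≤j)

degree-constant : ∀ c d → DegreeBelow (c ∷ []) (suc d)
degree-constant c d = degree-below λ { (suc j) _ → refl }

degree-linear : ∀ a b → DegreeBelow (a ∷ b ∷ []) 2
degree-linear a b = degree-below λ { (suc zero) (s≤s ()) ; (suc (suc j)) _ → refl }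

antidiagonal-≤ : ∀ {a b i j} → a + b ≤ i + j → a < i ⊎ b ≤ j
antidiagonal-≤ {a} {b} {i} {j} a+b≤i+j with a <? i
... | yes a<i = inj₁ a<i
... | no  a≮i = inj₂ (+-cancelˡ-≤ a b j (≤-trans a+b≤i+j (+-monoˡ-≤ j (≮⇒≥ a≮i))))

antidiagonal-≡ : ∀ {a b i j} → i + j ≡ a + b → i ≢ a → a < i ⊎ b < j
antidiagonal-≡ {a} {b} {i} {j} e i≢a with <-cmp i a
... | tri< i<a _ _ = inj₂ (+-cancelˡ-< a b j (subst (_< a + j) e (+-monoˡ-< j i<a)))
... | tri≈ _ i≡a _ = ⊥-elim (i≢a i≡a)
... | tri> _ _ a<i = inj₁ a<i

product-term-vanishes : ∀ {p q a b} → DegreeBelow p (suc a) → DegreeBelow q b →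
  ∀ i j → a < i ⊎ b ≤ j → coeff p i * coeff q j ≡ 0
product-term-vanishes {q = q} degp degq i j (inj₁ a<i) = cong (_* coeff q j) (vanishes degp i a<i)
product-term-vanishes {p = p} degp degq i j (inj₂ b≤j) =
  trans (cong (coeff p i *_) (vanishes degq j b≤j)) (*-zeroʳ (coeff p i))

⊗-degree : ∀ {p q a b} → DegreeBelow p (suc a) → DegreeBelow q b → DegreeBelow (p ⊗ q) (a + b)
⊗-degree {p} {q} degp degq = degree-below λ n a+b≤n →
  trans (coeff-⊗ p q n)
    (conv-zero _ n (λ i j e → product-term-vanishes degp degq i j
                                (antidiagonal-≤ (subst (_ ≤_) (sym e) a+b≤n))))

⊗-zeroʳ : ∀ p {q} → DegreeBelow q 0 → DegreeBelow (p ⊗ q) 0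
⊗-zeroʳ p {q} degq = degree-below λ n _ →
  trans (coeff-⊗ p q n)
    (conv-zero _ n (λ i j _ → trans (cong (coeff p i *_) (vanishes degq j z≤n)) (*-zeroʳ (coeff p i))))

⊗-top : ∀ {p q a b n} → DegreeBelow p (suc a) → DegreeBelow q (suc b) → a + b ≡ n →
  coeff (p ⊗ q) n ≡ coeff p a * coeff q b
⊗-top {p} {q} {a} {b} {n} degp degq e =
  trans (coeff-⊗ p q n)
    (conv-single _ a b e (λ i j e′ i≢a → product-term-vanishes degp degq i j
                                           (antidiagonal-≡ (trans e′ (sym e)) i≢a)))

shift-degree : ∀ p {d} → DegreeBelow p d → DegreeBelow (shift p) d
shift-degree []      _ = degree-below λ _ _ → refl
shift-degree (c ∷ p) {zero} deg =
  degree-⊕ constant-zero (⊗-zeroʳ (1 ∷ 1 ∷ []) (shift-degree p (degree-tail deg)))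
  where
  constant-zero : DegreeBelow (c ∷ []) 0
  constant-zero = degree-below λ { zero _ → vanishes deg 0 z≤n ; (suc j) _ → refl }
shift-degree (c ∷ p) {suc d} deg =
  degree-⊕ (degree-constant c d) (⊗-degree (degree-linear 1 1) (shift-degree p (degree-tail deg)))

PQ : ℕ → Poly × Poly
PQ k = (P k , Q k)

history : ∀ n → proj₂ (PQs (suc n)) ≡ applyDownFrom PQ (suc n)
history zero    = refl
history (suc n) = cong (PQ (suc n) ∷_) (history n)

reverse-applyDownFrom : ∀ {A : Set} (f : ℕ → A) n → reverse (applyDownFrom f n) ≡ applyUpTo f n
reverse-applyDownFrom f zero    = refl
reverse-applyDownFrom f (suc n) =
  trans (unfold-reverse (f n) (applyDownFrom f n))
    (trans (cong (_∷ʳ f n) (reverse-applyDownFrom f n)) (applyUpTo-∷ʳ f n))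

coeff-polySum-zipWith : ∀ {A : Set} (F : A → A → Poly) (y x : ℕ → A) n J →
  coeff (polySum (zipWith F (applyDownFrom y (suc n)) (applyUpTo x (suc n)))) J ≡
  conv (λ i j → coeff (F (y j) (x i)) J) n
coeff-polySum-zipWith F y x zero    J = trans (coeff-⊕ (F (y 0) (x 0)) [] J) (+-identityʳ _)
coeff-polySum-zipWith F y x (suc n) J =
  trans (coeff-⊕ (F (y (suc n)) (x 0)) _ J)
    (cong (coeff (F (y (suc n)) (x 0)) J +_) (coeff-polySum-zipWith F y (x ∘ suc) n J))

Q-coeff : ∀ n J → coeff (Q (suc (suc n))) J ≡ conv (λ i j → coeff (Q j ⊗ P i) J) (suc n)
Q-coeff n J = begin
    coeff (polySum (zipWith F L (reverse L))) J
  ≡⟨ cong (λ L → coeff (polySum (zipWith F L (reverse L))) J) (cong (PQ (suc n) ∷_) (history n)) ⟩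
    coeff (polySum (zipWith F D (reverse D))) J
  ≡⟨ cong (λ R → coeff (polySum (zipWith F D R)) J) (reverse-applyDownFrom PQ (suc (suc n))) ⟩
    coeff (polySum (zipWith F D (applyUpTo PQ (suc (suc n))))) J
  ≡⟨ coeff-polySum-zipWith F PQ PQ (suc n) J ⟩
    conv (λ i j → coeff (Q j ⊗ P i) J) (suc n)
  ∎
  where
  F : Poly × Poly → Poly × Poly → Poly
  F a b = proj₂ a ⊗ proj₁ b
  L : List (Poly × Poly)
  L = PQ (suc n) ∷ proj₂ (PQs (suc n))
  D : List (Poly × Poly)
  D = applyDownFrom PQ (suc (suc n))

-- ⌈a/2⌉ + ⌈b/2⌉ ≤ ⌈(a+b+1)/2⌉: the degree bound is compatible with the recursion for Q.
⌈/2⌉-subadditive : ∀ a b → ⌈ a /2⌉ + ⌈ b /2⌉ ≤ ⌈ suc (a + b) /2⌉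
⌈/2⌉-subadditive zero          b = ⌈n/2⌉-mono (n≤1+n b)
⌈/2⌉-subadditive (suc zero)    b = ≤-refl
⌈/2⌉-subadditive (suc (suc a)) b = s≤s (⌈/2⌉-subadditive a b)

DegreeBound : ℕ → Set
DegreeBound n = DegreeBelow (P n) (suc ⌈ n /2⌉) × DegreeBelow (Q n) (suc ⌈ n /2⌉)

-- The inductive step: Q_{n+2} is a sum of products Q_j P_i with i + j = n + 1, and
-- P_{n+2} adds the shift of P_{n+1}, whose degree bound is no larger.
degree-bound-step : ∀ n → (∀ {k} → k < n → DegreeBound k) → DegreeBound n
degree-bound-step zero          _  = degree-below (λ _ _ → refl) , degree-below (λ _ _ → refl)
degree-bound-step (suc zero)    _  = degree-linear 0 1 , degree-linear 0 1
degree-bound-step (suc (suc n)) IH =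
  degree-⊕ shifted degQ , degQ
  where
  shifted : DegreeBelow (shift (P (suc n))) (suc ⌈ suc (suc n) /2⌉)
  shifted = degree-mono (shift-degree (P (suc n)) (proj₁ (IH {suc n} ≤-refl)))
              (s≤s (⌈n/2⌉-mono (n≤1+n (suc n))))
  term-bound : ∀ i j → i + j ≡ suc n → ⌈ j /2⌉ + suc ⌈ i /2⌉ ≤ suc ⌈ suc (suc n) /2⌉
  term-bound i j e =
    ≤-trans (≤-reflexive (+-suc ⌈ j /2⌉ ⌈ i /2⌉))
      (≤-trans (s≤s (⌈/2⌉-subadditive j i))
        (≤-reflexive (cong (λ s → suc ⌈ suc s /2⌉) (trans (+-comm j i) e))))
  degQ : DegreeBelow (Q (suc (suc n))) (suc ⌈ suc (suc n) /2⌉)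
  degQ = degree-below λ J le → trans (Q-coeff n J) (conv-zero _ (suc n) (λ i j e →
    vanishes (⊗-degree (proj₂ (IH {j} (s≤s (subst (j ≤_) e (m≤n+m j i)))))
                       (proj₁ (IH {i} (s≤s (subst (i ≤_) e (m≤m+n i j))))))
             J (≤-trans (term-bound i j e) le)))

degree-bound : ∀ n → DegreeBound n
degree-bound = <-rec DegreeBound degree-bound-step

even-degree : ∀ q → DegreeBelow (P (double q)) (suc q) × DegreeBelow (Q (double q)) (suc q)
even-degree q =
  subst (λ d → DegreeBelow (P (double q)) (suc d) × DegreeBelow (Q (double q)) (suc d))
        (trans (cong ⌈_/2⌉ (double≡+ q)) (sym (n≡⌈n+n/2⌉ q)))
        (degree-bound (double q))

odd-degree : ∀ q →
  DegreeBelow (P (suc (double q))) (suc (suc q)) × DegreeBelow (Q (suc (double q))) (suc (suc q))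
odd-degree q =
  subst (λ d → DegreeBelow (P (suc (double q))) (suc (suc d)) × DegreeBelow (Q (suc (double q))) (suc (suc d)))
        (trans (cong ⌊_/2⌋ (double≡+ q)) (sym (n≡⌊n+n/2⌋ q)))
        (degree-bound (suc (double q)))

leading : ℕ → ℕ
leading q = coeff (P (suc (double q))) (suc q)

-- P_{2q+1} = P_{2q}(m+1) + Q_{2q+1} and the shifted term has degree ≤ q.
leading-Q : ∀ q → coeff (Q (suc (double q))) (suc q) ≡ leading q
leading-Q zero    = refl
leading-Q (suc r) =
  sym (trans (coeff-⊕ (shift (P (double (suc r)))) (Q (suc (double (suc r)))) (suc (suc r)))
             (cong (_+ coeff (Q (suc (double (suc r)))) (suc (suc r)))
                   (vanishes (shift-degree _ (proj₁ (even-degree (suc r)))) (suc (suc r)) ≤-refl)))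

-- [m^{r+2}] Q_{2r+3}: the even products stay below degree r + 2, the odd ones reach
-- it with top coefficient ℓ_i ℓ_j.
leading-recurrence : ∀ r → leading (suc r) ≡ conv (λ i j → leading i * leading j) r
leading-recurrence r = begin
    leading (suc r)
  ≡⟨ sym (leading-Q (suc r)) ⟩
    coeff (Q (suc (double (suc r)))) (suc (suc r))
  ≡⟨ Q-coeff (suc (double r)) (suc (suc r)) ⟩
    conv h (double (suc r))
  ≡⟨ conv-parity h r ⟩
    conv (λ i j → h (double i) (double j)) (suc r) + conv (λ i j → h (suc (double i)) (suc (double j))) r
  ≡⟨ cong₂ _+_ (conv-zero _ (suc r) even-terms) (conv-cong r _ _ odd-terms) ⟩
    conv (λ i j → leading i * leading j) r
  ∎
  where
  h : ℕ → ℕ → ℕ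
  h i j = coeff (Q j ⊗ P i) (suc (suc r))
  -- deg (Q_{2j} P_{2i}) ≤ i + j = r + 1
  even-terms : ∀ i j → i + j ≡ suc r → h (double i) (double j) ≡ 0
  even-terms i j e =
    vanishes (⊗-degree (proj₂ (even-degree j)) (proj₁ (even-degree i)))
      (suc (suc r)) (≤-reflexive (trans (+-suc j i) (cong suc (trans (+-comm j i) e))))
  -- Q_{2j+1} P_{2i+1} has degree exactly i + j + 2 = r + 2
  odd-terms : ∀ i j → i + j ≡ r → h (suc (double i)) (suc (double j)) ≡ leading i * leading j
  odd-terms i j e =
    trans (⊗-top (proj₂ (odd-degree j)) (proj₁ (odd-degree i))
                 (cong suc (trans (+-suc j i) (cong suc (trans (+-comm j i) e)))))
          (trans (cong (_* leading i) (leading-Q j)) (*-comm (leading j) (leading i)))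

-- ballot n k = [x^n] c(x)^k for the Catalan series c = 1 + x c²; the recursion is
-- c^{k+1} = c^k + x c^{k+2}.
ballot : ℕ → ℕ → ℕ
ballot zero    k       = 1
ballot (suc n) zero    = 0
ballot (suc n) (suc k) = ballot (suc n) k + ballot n (suc (suc k))

catalan : ℕ → ℕ
catalan n = ballot n 1

ballot-convolution : ∀ n k → conv (λ i j → catalan i * ballot j k) n ≡ ballot n (suc k)
ballot-convolution zero    k       = refl
ballot-convolution (suc n) zero    =
  trans (conv-single _ (suc n) 0 (cong suc (+-identityʳ n)) off-zero) (*-identityʳ _)
  where
  off-zero : ∀ i j → i + j ≡ suc n → i ≢ suc n → catalan i * ballot j 0 ≡ 0
  off-zero i zero    e i≢ = ⊥-elim (i≢ (trans (sym (+-identityʳ i)) e))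
  off-zero i (suc j) _ _  = *-zeroʳ (catalan i)
ballot-convolution (suc n) (suc k) =
  trans (conv-split (λ i j → catalan i * ballot j (suc k))
                    (λ i j → catalan i * ballot j k)
                    (λ i j → catalan i * ballot j (suc (suc k)))
                    (λ _ → refl) (λ i j → *-distribˡ-+ (catalan i) _ _) n)
        (cong₂ _+_ (ballot-convolution (suc n) k) (ballot-convolution n (suc (suc k))))

catalan-recurrence : ∀ r → catalan (suc r) ≡ conv (λ i j → catalan i * catalan j) r
catalan-recurrence r = sym (ballot-convolution r 1)

catalan-unique : ∀ (f : ℕ → ℕ) → f 0 ≡ 1 → (∀ r → f (suc r) ≡ conv (λ i j → f i * f j) r) →
  ∀ n → f n ≡ catalan n
catalan-unique f f₀ rec = <-rec (λ n → f n ≡ catalan n) step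
  where
  step : ∀ n → (∀ {m} → m < n → f m ≡ catalan m) → f n ≡ catalan n
  step zero    _  = f₀
  step (suc r) IH = begin
      f (suc r)                                 ≡⟨ rec r ⟩
      conv (λ i j → f i * f j) r                ≡⟨ conv-cong r _ _ (λ i j e → cong₂ _*_ (IH (i≤ e)) (IH (j≤ e))) ⟩
      conv (λ i j → catalan i * catalan j) r    ≡⟨ sym (catalan-recurrence r) ⟩
      catalan (suc r)                           ∎
    where
    i≤ : ∀ {i j} → i + j ≡ r → i < suc r
    i≤ {i} {j} e = s≤s (subst (i ≤_) e (m≤m+n i j))
    j≤ : ∀ {i j} → i + j ≡ r → j < suc r
    j≤ {i} {j} e = s≤s (subst (j ≤_) e (m≤n+m j i))

pascal : ∀ n k → suc n C suc k ≡ n C k + n C suc k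
pascal n k = sym (nCk+nC[k+1]≡[n+1]C[k+1] n k)

C-absorption : ∀ n k → suc k * (suc n C suc k) ≡ suc n * (n C k)
C-absorption zero    zero    = refl
C-absorption zero    (suc k) = *-zeroʳ (suc (suc k))
C-absorption (suc n) zero    = trans (+-identityʳ _) (trans (nC1≡n (suc (suc n))) (sym (*-identityʳ _)))
C-absorption (suc n) (suc k) = begin
    suc K * (suc N C suc K)
  ≡⟨ cong (suc K *_) (pascal N K) ⟩
    suc K * (N C K + N C suc K)
  ≡⟨ *-distribˡ-+ (suc K) (N C K) (N C suc K) ⟩
    (N C K + K * (N C K)) + suc K * (N C suc K)
  ≡⟨ cong₂ (λ x y → (N C K + x) + y) (C-absorption n k) (C-absorption n K) ⟩
    (N C K + N * (n C k)) + N * (n C K)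
  ≡⟨ +-assoc (N C K) _ _ ⟩
    N C K + (N * (n C k) + N * (n C K))
  ≡⟨ cong (N C K +_) (sym (*-distribˡ-+ N (n C k) (n C K))) ⟩
    N C K + N * (n C k + n C K)
  ≡⟨ cong (λ x → N C K + N * x) (sym (pascal n k)) ⟩
    suc N * (N C K)
  ∎
  where
  N : ℕ
  N = suc n
  K : ℕ
  K = suc k

C-middle : ∀ m → suc (suc (suc (double m))) C suc m ≡ suc (suc (suc (double m))) C suc (suc m)
C-middle m = begin
    W C suc m                   ≡⟨ cong (W C_) (sym W∸[m+2]≡m+1) ⟩
    W C (W ∸ suc (suc m))       ≡⟨ sym (nCk≡nC[n∸k] m+2≤W) ⟩
    W C suc (suc m)             ∎
  where
  W : ℕ
  W = suc (suc (suc (double m)))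
  W∸[m+2]≡m+1 : W ∸ suc (suc m) ≡ suc m
  W∸[m+2]≡m+1 = trans (cong (λ x → suc x ∸ m) (double≡+ m)) (m+n∸n≡m (suc m) m)
  m+2≤W : suc (suc m) ≤ W
  m+2≤W = s≤s (s≤s (≤-trans (m≤m+n m m) (≤-trans (≤-reflexive (sym (double≡+ m))) (n≤1+n _))))

ballot-one : ∀ k → ballot 1 k ≡ k
ballot-one zero    = refl
ballot-one (suc k) = trans (cong (_+ 1) (ballot-one k)) (+-comm k 1)

ballot-difference : ∀ n k M → k + double n ≡ M →
  ballot (suc n) (suc k) + suc (suc M) C n ≡ suc (suc M) C suc n
ballot-difference zero k M e = begin
    ballot 1 (suc k) + 1          ≡⟨ cong (_+ 1) (ballot-one (suc k)) ⟩
    suc k + 1                     ≡⟨ +-comm (suc k) 1 ⟩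
    suc (suc k)                   ≡⟨ cong (suc ∘ suc) (trans (sym (+-identityʳ k)) e) ⟩
    suc (suc M)                   ≡⟨ sym (nC1≡n (suc (suc M))) ⟩
    suc (suc M) C 1               ∎
ballot-difference (suc m) zero M refl = begin
    X + suc W C suc m                 ≡⟨ cong (X +_) (pascal W m) ⟩
    X + (W C m + W C suc m)           ≡⟨ sym (+-assoc X _ _) ⟩
    (X + W C m) + W C suc m           ≡⟨ cong₂ _+_ (ballot-difference m 1 (suc (double m)) refl)
                                                   (C-middle m) ⟩
    W C suc m + W C suc (suc m)       ≡⟨ sym (pascal W (suc m)) ⟩
    suc W C suc (suc m)               ∎
  where
  X : ℕ
  X = ballot (suc m) 2
  W : ℕ
  W = suc (suc (suc (double m)))
ballot-difference (suc m) (suc k) M refl = begin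
    (Y + Z) + suc V C suc m                 ≡⟨ cong ((Y + Z) +_) (pascal V m) ⟩
    (Y + Z) + (V C m + V C suc m)           ≡⟨ solve 4 (λ y z a b → (y :+ z) :+ (a :+ b) := (z :+ a) :+ (y :+ b))
                                                 refl Y Z (V C m) (V C suc m) ⟩
    (Z + V C m) + (Y + V C suc m)           ≡⟨ cong₂ _+_ (ballot-difference m (suc (suc k)) M₁ e₁)
                                                         (ballot-difference (suc m) k M₁ refl) ⟩
    V C suc m + V C suc (suc m)             ≡⟨ sym (pascal V (suc m)) ⟩
    suc V C suc (suc m)                     ∎
  where
  M₁ : ℕ
  M₁ = k + double (suc m)
  V : ℕ
  V = suc (suc M₁)
  Y : ℕ
  Y = ballot (suc (suc m)) (suc k)
  Z : ℕ
  Z = ballot (suc m) (suc (suc (suc k)))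
  e₁ : suc (suc k) + double m ≡ M₁
  e₁ = sym (trans (+-suc k (suc (double m))) (cong suc (+-suc k (double m))))

-- (q+1) C_q = binom(2q, q): the reflection formula with k = 0 gives
-- C_{m+1} = binom(2m+2, m+1) − binom(2m+2, m), and the two binomials are in ratio (m+2) : (m+1).
catalan-closed-form : ∀ q → suc q * catalan q ≡ double q C q
catalan-closed-form zero    = refl
catalan-closed-form (suc m) = +-cancelʳ-≡ (S * (N C m)) (S * catalan (suc m)) (N C suc m) (begin
    S * catalan (suc m) + S * (N C m)     ≡⟨ sym (*-distribˡ-+ S (catalan (suc m)) (N C m)) ⟩
    S * (catalan (suc m) + N C m)         ≡⟨ cong (S *_) (ballot-difference m 0 (double m) refl) ⟩
    N C suc m + suc m * (N C suc m)       ≡⟨ cong (N C suc m +_) ratio ⟩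
    N C suc m + S * (N C m)               ∎)
  where
  N : ℕ
  N = double (suc m)
  S : ℕ
  S = suc (suc m)
  -- binom(N+1, m+1) = binom(N, m) + binom(N, m+1) and N + 1 = (m+1) + (m+2)
  ratio : suc m * (N C suc m) ≡ S * (N C m)
  ratio = +-cancelˡ-≡ (suc m * (N C m)) _ _ (begin
      suc m * (N C m) + suc m * (N C suc m)   ≡⟨ sym (*-distribˡ-+ (suc m) (N C m) (N C suc m)) ⟩
      suc m * (N C m + N C suc m)             ≡⟨ cong (suc m *_) (sym (pascal N m)) ⟩
      suc m * (suc N C suc m)                 ≡⟨ C-absorption N m ⟩
      suc N * (N C m)                         ≡⟨ cong (_* (N C m)) suc-N≡ ⟩
      (suc m + S) * (N C m)                   ≡⟨ *-distribʳ-+ (N C m) (suc m) S ⟩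
      suc m * (N C m) + S * (N C m)           ∎)
    where
    suc-N≡ : suc N ≡ suc m + S
    suc-N≡ = cong suc (trans (cong (suc ∘ suc) (double≡+ m))
                             (sym (trans (+-suc m (suc m)) (cong suc (+-suc m m)))))

catalan-formula : ∀ q → catalan q ≡ (double q C q) / suc q
catalan-formula q = begin
    catalan q                       ≡⟨ sym (m*n/n≡m (catalan q) (suc q)) ⟩
    (catalan q * suc q) / suc q     ≡⟨ cong (_/ suc q) (trans (*-comm (catalan q) (suc q))
                                                              (catalan-closed-form q)) ⟩
    (double q C q) / suc q          ∎

2*≡double : ∀ q → 2 * q ≡ double q
2*≡double q = trans (cong (q +_) (+-identityʳ q)) (sym (double≡+ q))

mainTheorem8 : (q : ℕ) →
    (coeff (P (2 * q + 1)) (q + 1) ≡ ((2 * q) C q) / suc q)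
    × ((j : ℕ) → q + 1 < j → coeff (P (2 * q + 1)) j ≡ 0)
mainTheorem8 q = leading-coefficient , higher-coefficients
  where
  2q+1≡ : 2 * q + 1 ≡ suc (double q)
  2q+1≡ = trans (+-comm (2 * q) 1) (cong suc (2*≡double q))
  leading-coefficient : coeff (P (2 * q + 1)) (q + 1) ≡ ((2 * q) C q) / suc q
  leading-coefficient = begin
    coeff (P (2 * q + 1)) (q + 1)   ≡⟨ cong₂ (λ n j → coeff (P n) j) 2q+1≡ (+-comm q 1) ⟩
    leading q                       ≡⟨ catalan-unique leading refl leading-recurrence q ⟩
    catalan q                       ≡⟨ catalan-formula q ⟩
    (double q C q) / suc q          ≡⟨ cong (λ n → (n C q) / suc q) (sym (2*≡double q)) ⟩
    ((2 * q) C q) / suc q           ∎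
  higher-coefficients : (j : ℕ) → q + 1 < j → coeff (P (2 * q + 1)) j ≡ 0
  higher-coefficients j q+1<j =
    trans (cong (λ n → coeff (P n) j) 2q+1≡)
      (vanishes (proj₁ (odd-degree q)) j (subst (λ s → suc s ≤ j) (+-comm q 1) q+1<j))
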